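{- Let $a,b$ be indeterminates and define the division polynomials $\psi_m\in\mathbb{Z}[x,y,a,b]$ by $\psi_0=0$, $\psi_1=1$, $\psi_2=2y$, $\psi_3=3x^4+6ax^2+12bx-a^2$, $\psi_4=4y(x^6+5ax^4+20bx^3-5a^2x^2-4abx-8b^2-a^3)$, $\psi_{2m+1}=\psi_{m+2}\psi_m^3-\psi_{m-1}\psi_{m+1}^3$ for $m\ge 2$, and $2y\psi_{2m}=\psi_m(\psi_{m+2}\psi_{m-1}^2-\psi_{m-2}\psi_{m+1}^2)$ for $m\ge 3$. Work modulo the relation $y^2=x^3+ax+b$, viewing expressions as polynomials in $x$ (resp. $y$ times a polynomial in $x$) with coefficients in $\mathbb{Q}[a,b]$. Then for every integer $n\ge 1$: if $n$ is odd, $$\psi_n=n\,x^{\frac{n^2-1}{2}}+\frac{n(n^2-1)(n^2+6)}{60}\,a\,x^{\frac{n^2-5}{2}}+(\text{terms of lower degree in }x),$$ and if $n$ is even, $$\psi_n=n\,y\left(x^{\frac{n^2-4}{2}}+\frac{(n^2-1)(n^2+6)-30}{60}\,a\,x^{\frac{n^2-8}{2}}+(\text{terms of lower degree in }x)\right).$$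
   Context: For odd $n$, $\psi_n\in\mathbb{Z}[x,y^2,a,b]$, and for even $n$, $(2y)^{ -1}\psi_n\in\mathbb{Z}[x,y^2,a,b]$; after substituting $y^2=x^3+ax+b$ these become polynomials in $x$ with coefficients in $\mathbb{Z}[a,b]$, and "lower degree terms" refers to the degree in $x$. -}

module Defs where

open import Data.List using (List; []; _∷_; map)
open import Data.Integer as ℤ using (ℤ; +_)
open import Data.Nat as ℕ using (ℕ; zero; suc; _≤_; _<_; _∸_; ⌊_/2⌋)
open import Data.Product using (_×_; _,_; proj₁; proj₂)
open import Relation.Binary.PropositionalEquality using (_≡_)

-- Generic dense univariate polynomials (coefficient lists, lowest
-- degree first) over a coefficient type with ring operations.
-- Equality is coefficientwise (so trailing zeros do not matter).

record Ops (A : Set) : Set₁ where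
  field
    0# 1# : A
    _+_ _*_ : A → A → A
    -_ : A → A
    _≈_ : A → A → Set

module Poly {A : Set} (O : Ops A) where
  open Ops O

  addP : List A → List A → List A
  addP [] q = q
  addP (x ∷ p) [] = x ∷ p
  addP (x ∷ p) (y ∷ q) = (x + y) ∷ addP p q

  negP : List A → List A
  negP = map -_

  mulP : List A → List A → List A
  mulP [] q = []
  mulP (x ∷ p) q = addP (map (x *_) q) (0# ∷ mulP p q)

  coeff : List A → ℕ → A
  coeff [] _ = 0#
  coeff (x ∷ p) zero = x
  coeff (x ∷ p) (suc n) = coeff p n

  _≈P_ : List A → List A → Set
  p ≈P q = ∀ i → coeff p i ≈ coeff q i

  ops : Ops (List A)
  ops = record { 0# = [] ; 1# = 1# ∷ [] ; _+_ = addP ; _*_ = mulP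
               ; -_ = negP ; _≈_ = _≈P_ }

ℤops : Ops ℤ
ℤops = record { 0# = + 0 ; 1# = + 1 ; _+_ = ℤ._+_ ; _*_ = ℤ._*_
              ; -_ = ℤ.-_ ; _≈_ = _≡_ }

Zb : Set
Zb = List ℤ
Zbops : Ops Zb
Zbops = Poly.ops ℤops

Zab : Set
Zab = List Zb
Zabops : Ops Zab
Zabops = Poly.ops Zbops

Zxab : Set
Zxab = List Zab
Zxabops : Ops Zxab
Zxabops = Poly.ops Zabops

module AB = Ops Zabops
module XAB = Ops Zxabops

coeffX : Zxab → ℕ → Zab
coeffX = Poly.coeff Zabops

cAB : ℤ → Zab
cAB z = (z ∷ []) ∷ []

aAB : Zab
aAB = [] ∷ ((+ 1 ∷ []) ∷ [])

bAB : Zab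
bAB = (+ 0 ∷ + 1 ∷ []) ∷ []

-- x^3 + a x + b  in ℤ[a,b][x]
Fx : Zxab
Fx = bAB ∷ aAB ∷ [] ∷ cAB (+ 1) ∷ []

-- The ring R = ℤ[x,y,a,b]/(y² - x³ - a x - b), whose elements are
-- uniquely  f + y g  with f, g ∈ ℤ[x,a,b]; represented as (f , g).

R : Set
R = Zxab × Zxab

_≈R_ : R → R → Set
(f , g) ≈R (f' , g') = (f XAB.≈ f') × (g XAB.≈ g')

_+R_ : R → R → R
(f , g) +R (f' , g') = (f XAB.+ f') , (g XAB.+ g')

-R_ : R → R
-R (f , g) = (XAB.- f) , (XAB.- g)

_-R_ : R → R → R
p -R q = p +R (-R q)

-- (f + y g)(f' + y g') = f f' + (x³+ax+b) g g' + y (f g' + g f')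
_*R_ : R → R → R
(f , g) *R (f' , g') =
  ((f XAB.* f') XAB.+ (Fx XAB.* (g XAB.* g'))) , ((f XAB.* g') XAB.+ (g XAB.* f'))

infixl 6 _+R_ _-R_
infixl 7 _*R_
infix 4 _≈R_

constR : ℤ → R
constR z = (cAB z ∷ []) , []

X Y A B : R
X = ([] ∷ cAB (+ 1) ∷ []) , []
Y = [] , (cAB (+ 1) ∷ [])
A = (aAB ∷ []) , []
B = (bAB ∷ []) , []

_^R_ : R → ℕ → R
p ^R zero = constR (+ 1)
p ^R suc n = p *R (p ^R n)

_·R_ : ℤ → R → R
z ·R p = constR z *R p
infixr 8 _^R_
infixl 7 _·R_

record IsDivisionPolynomials (ψ : ℕ → R) : Set where
  field
    ψ₀ : ψ 0 ≈R constR (+ 0)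
    ψ₁ : ψ 1 ≈R constR (+ 1)
    ψ₂ : ψ 2 ≈R (+ 2) ·R Y
    ψ₃ : ψ 3 ≈R (+ 3) ·R X ^R 4 +R (+ 6) ·R A *R X ^R 2
                 +R (+ 12) ·R B *R X -R A ^R 2
    ψ₄ : ψ 4 ≈R (+ 4) ·R Y *R
                 (X ^R 6 +R (+ 5) ·R A *R X ^R 4 +R (+ 20) ·R B *R X ^R 3
                  -R (+ 5) ·R A ^R 2 *R X ^R 2 -R (+ 4) ·R A *R B *R X
                  -R (+ 8) ·R B ^R 2 -R A ^R 3)
    ψ-odd  : ∀ m → 2 ≤ m →
             ψ (2 ℕ.* m ℕ.+ 1) ≈R ψ (m ℕ.+ 2) *R ψ m ^R 3
                                  -R ψ (m ∸ 1) *R ψ (m ℕ.+ 1) ^R 3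
    ψ-even : ∀ m → 3 ≤ m →
             (+ 2) ·R Y *R ψ (2 ℕ.* m) ≈R
               ψ m *R (ψ (m ℕ.+ 2) *R ψ (m ∸ 1) ^R 2
                       -R ψ (m ∸ 2) *R ψ (m ℕ.+ 1) ^R 2)

-- "h = c x^t + (N/60) a x^(t-2) + (terms of lower degree in x)"
-- for h ∈ ℤ[a,b][x], c, N ∈ ℤ. (The x^(t-1) coefficient vanishes; the
-- x^(t-2) clause is stated as 60·coeff = N·a to stay in ℤ[a,b]; clauses
-- about negative exponents are vacuous.)

LeadingShape : Zxab → ℕ → ℤ → ℤ → Set
LeadingShape h t c N =
  (∀ d → t < d → coeffX h d AB.≈ AB.0#) ×
  (coeffX h t AB.≈ cAB c) ×
  (1 ≤ t → coeffX h (t ∸ 1) AB.≈ AB.0#) ×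
  (2 ≤ t → (cAB (+ 60) AB.* coeffX h (t ∸ 2)) AB.≈ (cAB N AB.* aAB))

oddTop evenTop : ℕ → ℕ
oddTop n = ⌊ n ℕ.* n ∸ 1 /2⌋
evenTop n = ⌊ n ℕ.* n ∸ 4 /2⌋

oddN evenN : ℕ → ℤ
oddN n = (+ n) ℤ.* ((+ (n ℕ.* n)) ℤ.- + 1) ℤ.* ((+ (n ℕ.* n)) ℤ.+ + 6)
evenN n = (+ n) ℤ.* (((+ (n ℕ.* n)) ℤ.- + 1) ℤ.* ((+ (n ℕ.* n)) ℤ.+ + 6) ℤ.- + 30)

module Submission where

-- Count y as having degree 3/2: as y² = x³ + ax + b we have
-- y = x^{3/2} (1 + (30/60) a x⁻² + …).  In this weighting every ψₙ (n ≥ 1) has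
-- the same kind of top, uniformly in the parity of n:
--     ψₙ = n x^{(n²-1)/2} + (n(n²-1)(n²+6)/60) a x^{(n²-5)/2} + … ;
-- for even n, dividing off y lowers the second coefficient by 30n, which gives
-- the form (n²-1)(n²+6) - 30 of the statement.  Such "weighted shapes" (weighted
-- degree D, leading coefficient c, second coefficient M/60) multiply like
-- leading terms: (D, c, M)·(E, d, N) = (D + E, cd, cN + dM).  So the recurrences
-- for ψ₂ₘ₊₁ and for 2y ψ₂ₘ preserve the expected shape by polynomial identities
-- in m, and strong induction from ψ₁, …, ψ₄ (checked by evaluation) shows that
-- every ψₙ has the expected shape.

open import Defs
open import Level using (0ℓ)
open import Algebra.Bundles using (CommutativeRing)
open import Algebra.Structures using (IsCommutativeRing)
open import Data.List using (List; []; _∷_; map; length; replicate; applyUpTo; _++_; drop)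
open import Data.Nat as ℕ using (ℕ; zero; suc; z≤n; s≤s; ⌊_/2⌋)
import Data.Nat.Properties as ℕP
open import Data.Nat.Induction using (<-rec)
import Data.Nat.Tactic.RingSolver as ℕ-Solver
open import Data.Integer as ℤ using (ℤ; +_)
import Data.Integer.Properties as ℤP
open import Data.Integer.Tactic.RingSolver using (solve-∀)
open import Data.Product using (_×_; _,_; proj₁; proj₂)
open import Data.Sum using (inj₁; inj₂)
open import Data.Empty using (⊥-elim)
open import Relation.Nullary using (Dec; yes)
open import Relation.Nullary.Decidable using (map′; _×-dec_; True; toWitness)
import Relation.Binary.Reasoning.Setoid as SetoidReasoning
open import Relation.Binary.PropositionalEquality as P using (_≡_; _≢_)

-- The coefficientwise equality of
-- polynomials is a function type from which Agda cannot recover the two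
-- polynomials by unification; its boxed version is a record type, from which it can.
record Boxed {A : Set} (_∼_ : A → A → Set) (x y : A) : Set where
  constructor box
  field unbox : x ∼ y
open Boxed

boxed : ∀ {A : Set} {_∼_ : A → A → Set} {_+_ _*_ : A → A → A} {neg : A → A} {0# 1# : A} →
        IsCommutativeRing _∼_ _+_ _*_ neg 0# 1# → IsCommutativeRing (Boxed _∼_) _+_ _*_ neg 0# 1#
boxed R = record
  { isRing = record
    { +-isAbelianGroup = record
      { isGroup = record
        { isMonoid = record
          { isSemigroup = record
            { isMagma = record
              { isEquivalence = record
                { refl = box refl ; sym = λ (box p) → box (sym p)
                ; trans = λ (box p) (box q) → box (trans p q) }
              ; ∙-cong = λ (box p) (box q) → box (+-cong p q) }
            ; assoc = λ x y z → box (+-assoc x y z) }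
          ; identity = (λ x → box (+-identityˡ x)) , (λ x → box (+-identityʳ x)) }
        ; inverse = (λ x → box (-‿inverseˡ x)) , (λ x → box (-‿inverseʳ x))
        ; ⁻¹-cong = λ (box p) → box (-‿cong p) }
      ; comm = λ x y → box (+-comm x y) }
    ; *-cong = λ (box p) (box q) → box (*-cong p q)
    ; *-assoc = λ x y z → box (*-assoc x y z)
    ; *-identity = (λ x → box (*-identityˡ x)) , (λ x → box (*-identityʳ x))
    ; distrib = (λ x y z → box (distribˡ x y z)) , (λ x y z → box (distribʳ x y z)) }
  ; *-comm = λ x y → box (*-comm x y) }
  where open IsCommutativeRing R

-- The polynomials form a commutative ring again, so the module can
-- be instantiated repeatedly (ℤ[b], ℤ[a,b], ℤ[a,b][x]).
module Polynomials {A : Set} (O : Ops A)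
  (isCR : IsCommutativeRing (Boxed (Ops._≈_ O)) (Ops._+_ O) (Ops._*_ O) (Ops.-_ O) (Ops.0# O) (Ops.1# O))
  where

  open Poly O using (addP; negP; mulP; coeff; _≈P_)

  coeffRing : CommutativeRing 0ℓ 0ℓ
  coeffRing = record { isCommutativeRing = isCR }

  open CommutativeRing coeffRing
  open import Algebra.Properties.Ring ring using (-0#≈0#; -‿distribˡ-*; -‿distribʳ-*; +-cancelʳ)
  open import Algebra.Properties.CommutativeSemigroup +-commutativeSemigroup
    using () renaming (interchange to +-interchange; x∙yz≈y∙xz to +-left-comm)
  open import Algebra.Properties.CommutativeSemigroup *-commutativeSemigroup
    using () renaming (x∙yz≈y∙xz to *-left-comm)
  open SetoidReasoning setoid

  infix 4 _≋_
  _≋_ : List A → List A → Set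
  _≋_ = Boxed _≈P_

  coeffwise : ∀ {p q} → (∀ i → coeff p i ≈ coeff q i) → p ≋ q
  coeffwise h = box (λ i → unbox (h i))

  at : ∀ {p q} → p ≋ q → ∀ i → coeff p i ≈ coeff q i
  at (box h) i = box (h i)

  ≋-refl : ∀ {p} → p ≋ p
  ≋-refl = coeffwise (λ i → refl)

  ≋-sym : ∀ {p q} → p ≋ q → q ≋ p
  ≋-sym h = coeffwise (λ i → sym (at h i))

  ≋-trans : ∀ {p q r} → p ≋ q → q ≋ r → p ≋ r
  ≋-trans h h' = coeffwise (λ i → trans (at h i) (at h' i))

  cons-cong : ∀ {x y p q} → x ≈ y → p ≋ q → (x ∷ p) ≋ (y ∷ q)
  cons-cong e h = coeffwise λ { zero → e ; (suc i) → at h i }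

  coeff-+ : ∀ p q i → coeff (addP p q) i ≈ coeff p i + coeff q i
  coeff-+ [] q i = sym (+-identityˡ _)
  coeff-+ (x ∷ p) [] zero = sym (+-identityʳ x)
  coeff-+ (x ∷ p) [] (suc i) = sym (+-identityʳ _)
  coeff-+ (x ∷ p) (y ∷ q) zero = refl
  coeff-+ (x ∷ p) (y ∷ q) (suc i) = coeff-+ p q i

  coeff-neg : ∀ p i → coeff (negP p) i ≈ - coeff p i
  coeff-neg [] i = sym -0#≈0#
  coeff-neg (x ∷ p) zero = refl
  coeff-neg (x ∷ p) (suc i) = coeff-neg p i

  coeff-scale : ∀ k p i → coeff (map (k *_) p) i ≈ k * coeff p i
  coeff-scale k [] i = sym (zeroʳ k)
  coeff-scale k (x ∷ p) zero = refl
  coeff-scale k (x ∷ p) (suc i) = coeff-scale k p i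

  coeff-mul-cons : ∀ x p q i → coeff (mulP (x ∷ p) q) i ≈ x * coeff q i + coeff (0# ∷ mulP p q) i
  coeff-mul-cons x p q i = trans (coeff-+ (map (x *_) q) (0# ∷ mulP p q) i) (+-congʳ (coeff-scale x q i))

  []≋[0] : [] ≋ (0# ∷ [])
  []≋[0] = coeffwise λ { zero → refl ; (suc i) → refl }

  const : A → List A
  const x = x ∷ []

  mul-const : ∀ k p → mulP (const k) p ≋ map (k *_) p
  mul-const k p = coeffwise λ i → begin
    coeff (mulP (const k) p) i                   ≈⟨ coeff-mul-cons k [] p i ⟩
    k * coeff p i + coeff (0# ∷ []) i            ≈⟨ +-congˡ (at []≋[0] i) ⟨
    k * coeff p i + 0#                           ≈⟨ +-identityʳ _ ⟩
    k * coeff p i                                ≈⟨ coeff-scale k p i ⟨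
    coeff (map (k *_) p) i                       ∎

  const-* : ∀ x y → mulP (const x) (const y) ≋ const (x * y)
  const-* x y = mul-const x (const y)

  +-cong-P : ∀ {p p' q q'} → p ≋ p' → q ≋ q' → addP p q ≋ addP p' q'
  +-cong-P {p} {p'} {q} {q'} h h' = coeffwise λ i → begin
    coeff (addP p q) i        ≈⟨ coeff-+ p q i ⟩
    coeff p i + coeff q i     ≈⟨ +-cong (at h i) (at h' i) ⟩
    coeff p' i + coeff q' i   ≈⟨ coeff-+ p' q' i ⟨
    coeff (addP p' q') i      ∎

  neg-cong-P : ∀ {p p'} → p ≋ p' → negP p ≋ negP p'
  neg-cong-P {p} {p'} h = coeffwise λ i →
    trans (coeff-neg p i) (trans (-‿cong (at h i)) (sym (coeff-neg p' i)))

  scale-cong : ∀ {k k' p p'} → k ≈ k' → p ≋ p' → map (k *_) p ≋ map (k' *_) p'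
  scale-cong {k} {k'} {p} {p'} e h = coeffwise λ i →
    trans (coeff-scale k p i) (trans (*-cong e (at h i)) (sym (coeff-scale k' p' i)))

  mul-zero-left : ∀ p q → p ≋ [] → mulP p q ≋ []
  mul-zero-left [] q h = ≋-refl
  mul-zero-left (x ∷ p) q h = coeffwise λ i → trans (coeff-mul-cons x p q i) (tail i)
    where
    x≈0 : x ≈ 0#
    x≈0 = at h 0
    pq≈0 : mulP p q ≋ []
    pq≈0 = mul-zero-left p q (coeffwise (λ j → at h (suc j)))
    tail : ∀ i → x * coeff q i + coeff (0# ∷ mulP p q) i ≈ 0#
    tail zero = trans (+-cong (trans (*-congʳ x≈0) (zeroˡ _)) refl) (+-identityʳ 0#)
    tail (suc i) = trans (+-cong (trans (*-congʳ x≈0) (zeroˡ _)) (at pq≈0 i)) (+-identityʳ 0#)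

  mul-zero-right : ∀ p → mulP p [] ≋ []
  mul-zero-right [] = ≋-refl
  mul-zero-right (x ∷ p) = coeffwise λ i → trans (coeff-mul-cons x p [] i) (tail i)
    where
    tail : ∀ i → x * 0# + coeff (0# ∷ mulP p []) i ≈ 0#
    tail zero = trans (+-cong (zeroʳ x) refl) (+-identityʳ 0#)
    tail (suc i) = trans (+-cong (zeroʳ x) (at (mul-zero-right p) i)) (+-identityʳ 0#)

  mul-by-x : ∀ p q → mulP (0# ∷ p) q ≋ (0# ∷ mulP p q)
  mul-by-x p q = coeffwise λ i →
    trans (coeff-mul-cons 0# p q i) (trans (+-congʳ (zeroˡ _)) (+-identityˡ _))

  -- Multiplication respects _≋_ in each argument (a vanishing list may be
  -- shorter than its equal).
  mul-congˡ : ∀ {p p'} q → p ≋ p' → mulP p q ≋ mulP p' q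
  mul-congˡ {[]} {p'} q h = ≋-sym (mul-zero-left p' q (≋-sym h))
  mul-congˡ {x ∷ p} {[]} q h = mul-zero-left (x ∷ p) q h
  mul-congˡ {x ∷ p} {x' ∷ p'} q h =
    +-cong-P (scale-cong (at h 0) ≋-refl) (cons-cong refl (mul-congˡ {p} {p'} q (coeffwise (λ j → at h (suc j)))))

  mul-congʳ : ∀ p {q q'} → q ≋ q' → mulP p q ≋ mulP p q'
  mul-congʳ [] h = ≋-refl
  mul-congʳ (x ∷ p) h = +-cong-P (scale-cong refl h) (cons-cong refl (mul-congʳ p h))

  mul-distribʳ : ∀ p p' r → mulP (addP p p') r ≋ addP (mulP p r) (mulP p' r)
  mul-distribʳ [] p' r = ≋-refl
  mul-distribʳ (x ∷ p) [] r = coeffwise λ i → sym (trans (coeff-+ (mulP (x ∷ p) r) [] i) (+-identityʳ _))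
  mul-distribʳ (x ∷ p) (x' ∷ p') r = coeffwise λ i → begin
    coeff (mulP ((x + x') ∷ addP p p') r) i
      ≈⟨ coeff-mul-cons (x + x') (addP p p') r i ⟩
    (x + x') * coeff r i + coeff (0# ∷ mulP (addP p p') r) i
      ≈⟨ +-cong (distribʳ _ x x') (at (cons-cong (sym (+-identityʳ 0#)) (mul-distribʳ p p' r)) i) ⟩
    (x * coeff r i + x' * coeff r i) + coeff (addP (0# ∷ mulP p r) (0# ∷ mulP p' r)) i
      ≈⟨ +-congˡ (coeff-+ (0# ∷ mulP p r) (0# ∷ mulP p' r) i) ⟩
    (x * coeff r i + x' * coeff r i) + (coeff (0# ∷ mulP p r) i + coeff (0# ∷ mulP p' r) i)
      ≈⟨ +-interchange _ _ _ _ ⟩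
    (x * coeff r i + coeff (0# ∷ mulP p r) i) + (x' * coeff r i + coeff (0# ∷ mulP p' r) i)
      ≈⟨ +-cong (coeff-mul-cons x p r i) (coeff-mul-cons x' p' r i) ⟨
    coeff (mulP (x ∷ p) r) i + coeff (mulP (x' ∷ p') r) i
      ≈⟨ coeff-+ (mulP (x ∷ p) r) (mulP (x' ∷ p') r) i ⟨
    coeff (addP (mulP (x ∷ p) r) (mulP (x' ∷ p') r)) i ∎

  scale-mul : ∀ k q r → mulP (map (k *_) q) r ≋ map (k *_) (mulP q r)
  scale-mul k [] r = ≋-refl
  scale-mul k (y ∷ q) r = coeffwise λ i → begin
    coeff (mulP ((k * y) ∷ map (k *_) q) r) i
      ≈⟨ coeff-mul-cons (k * y) (map (k *_) q) r i ⟩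
    k * y * coeff r i + coeff (0# ∷ mulP (map (k *_) q) r) i
      ≈⟨ +-cong (*-assoc k y _) (at (cons-cong (sym (zeroʳ k)) (scale-mul k q r)) i) ⟩
    k * (y * coeff r i) + coeff (map (k *_) (0# ∷ mulP q r)) i
      ≈⟨ +-congˡ (coeff-scale k (0# ∷ mulP q r) i) ⟩
    k * (y * coeff r i) + k * coeff (0# ∷ mulP q r) i
      ≈⟨ distribˡ k _ _ ⟨
    k * (y * coeff r i + coeff (0# ∷ mulP q r) i)
      ≈⟨ *-congˡ (coeff-mul-cons y q r i) ⟨
    k * coeff (mulP (y ∷ q) r) i
      ≈⟨ coeff-scale k (mulP (y ∷ q) r) i ⟨
    coeff (map (k *_) (mulP (y ∷ q) r)) i ∎

  mul-cons-right : ∀ p y q → mulP p (y ∷ q) ≋ addP (map (y *_) p) (0# ∷ mulP p q)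
  mul-cons-right [] y q = coeffwise λ { zero → refl ; (suc i) → refl }
  mul-cons-right (x ∷ p) y q = coeffwise λ
    { zero → +-congʳ (*-comm x y)
    ; (suc i) → begin
        coeff (addP (map (x *_) q) (mulP p (y ∷ q))) i
          ≈⟨ trans (coeff-+ (map (x *_) q) (mulP p (y ∷ q)) i) (+-congʳ (coeff-scale x q i)) ⟩
        x * coeff q i + coeff (mulP p (y ∷ q)) i
          ≈⟨ +-congˡ (trans (at (mul-cons-right p y q) i) (coeff-+ (map (y *_) p) (0# ∷ mulP p q) i)) ⟩
        x * coeff q i + (coeff (map (y *_) p) i + coeff (0# ∷ mulP p q) i)
          ≈⟨ +-left-comm _ _ _ ⟩
        coeff (map (y *_) p) i + (x * coeff q i + coeff (0# ∷ mulP p q) i)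
          ≈⟨ +-congˡ (coeff-mul-cons x p q i) ⟨
        coeff (map (y *_) p) i + coeff (mulP (x ∷ p) q) i
          ≈⟨ coeff-+ (map (y *_) p) (mulP (x ∷ p) q) i ⟨
        coeff (addP (map (y *_) (x ∷ p)) (0# ∷ mulP (x ∷ p) q)) (suc i) ∎ }

  mul-comm : ∀ p q → mulP p q ≋ mulP q p
  mul-comm [] q = ≋-sym (mul-zero-right q)
  mul-comm (x ∷ p) q = ≋-trans (+-cong-P ≋-refl (cons-cong refl (mul-comm p q))) (≋-sym (mul-cons-right q x p))

  mul-assoc : ∀ p q r → mulP (mulP p q) r ≋ mulP p (mulP q r)
  mul-assoc [] q r = ≋-refl
  mul-assoc (x ∷ p) q r =
    ≋-trans (mul-distribʳ (map (x *_) q) (0# ∷ mulP p q) r)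
            (+-cong-P (scale-mul x q r) (≋-trans (mul-by-x (mulP p q) r) (cons-cong refl (mul-assoc p q r))))

  mul-identityˡ : ∀ q → mulP (const 1#) q ≋ q
  mul-identityˡ q = ≋-trans (mul-const 1# q) (coeffwise λ i → trans (coeff-scale 1# q i) (*-identityˡ _))

  polyIsCommutativeRing : IsCommutativeRing _≋_ addP mulP negP [] (1# ∷ [])
  polyIsCommutativeRing = record
    { isRing = record
      { +-isAbelianGroup = record
        { isGroup = record
          { isMonoid = record
            { isSemigroup = record
              { isMagma = record
                { isEquivalence = record { refl = ≋-refl ; sym = ≋-sym ; trans = ≋-trans }
                ; ∙-cong = +-cong-P }
              ; assoc = λ p q r → coeffwise λ i → begin
                  coeff (addP (addP p q) r) i             ≈⟨ trans (coeff-+ (addP p q) r i) (+-congʳ (coeff-+ p q i)) ⟩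
                  coeff p i + coeff q i + coeff r i       ≈⟨ +-assoc _ _ _ ⟩
                  coeff p i + (coeff q i + coeff r i)     ≈⟨ trans (coeff-+ p (addP q r) i) (+-congˡ (coeff-+ q r i)) ⟨
                  coeff (addP p (addP q r)) i             ∎ }
            ; identity = (λ p → ≋-refl) , (λ p → coeffwise λ i → trans (coeff-+ p [] i) (+-identityʳ _)) }
          ; inverse = (λ p → coeffwise λ i → trans (coeff-+ (negP p) p i) (trans (+-congʳ (coeff-neg p i)) (-‿inverseˡ _)))
                    , (λ p → coeffwise λ i → trans (coeff-+ p (negP p) i) (trans (+-congˡ (coeff-neg p i)) (-‿inverseʳ _)))
          ; ⁻¹-cong = neg-cong-P }
        ; comm = λ p q → coeffwise λ i → trans (coeff-+ p q i) (trans (+-comm _ _) (sym (coeff-+ q p i))) }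
      ; *-cong = λ {p} {p'} {q} {q'} h h' → ≋-trans (mul-congˡ q h) (mul-congʳ p' h')
      ; *-assoc = mul-assoc
      ; *-identity = mul-identityˡ , (λ p → ≋-trans (mul-comm p (1# ∷ [])) (mul-identityˡ p))
      ; distrib = (λ p q r → ≋-trans (mul-comm p (addP q r)) (≋-trans (mul-distribʳ q r p)
                                       (+-cong-P (mul-comm q p) (mul-comm r p))))
                , (λ r p q → mul-distribʳ p q r) }
    ; *-comm = mul-comm }

  +-vanishingʳ : ∀ p {q} → q ≋ [] → addP p q ≋ p
  +-vanishingʳ p {q} h = coeffwise λ i → trans (coeff-+ p q i) (trans (+-congˡ (at h i)) (+-identityʳ _))

  +-vanishingˡ : ∀ {p} q → p ≋ [] → addP p q ≋ q
  +-vanishingˡ {p} q h = coeffwise λ i → trans (coeff-+ p q i) (trans (+-congʳ (at h i)) (+-identityˡ _))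

  *-vanishingʳ : ∀ p {q} → q ≋ [] → mulP p q ≋ []
  *-vanishingʳ p {q} h = ≋-trans (mul-comm p q) (mul-zero-left q p h)

  NonZeroDivisor : A → Set
  NonZeroDivisor k = ∀ z → k * z ≈ 0# → z ≈ 0#

  cancel : ∀ k → NonZeroDivisor k → ∀ {x y} → k * x ≈ k * y → x ≈ y
  cancel k nzd {x} {y} kx≈ky = begin
    x               ≈⟨ x≈y+[x-y] ⟩
    y + (x - y)     ≈⟨ +-congˡ (nzd (x - y) k[x-y]≈0) ⟩
    y + 0#          ≈⟨ +-identityʳ y ⟩
    y               ∎
    where
    x≈y+[x-y] : x ≈ y + (x - y)
    x≈y+[x-y] = sym (trans (+-left-comm y x (- y)) (trans (+-congˡ (-‿inverseʳ y)) (+-identityʳ x)))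
    k[x-y]≈0 : k * (x - y) ≈ 0#
    k[x-y]≈0 = begin
      k * (x - y)          ≈⟨ distribˡ k x (- y) ⟩
      k * x + k * - y      ≈⟨ +-cong kx≈ky (sym (-‿distribʳ-* k y)) ⟩
      k * y - k * y        ≈⟨ -‿inverseʳ (k * y) ⟩
      0#                   ∎

  const-nonZeroDivisor : ∀ k → NonZeroDivisor k → ∀ p → mulP (const k) p ≋ [] → p ≋ []
  const-nonZeroDivisor k nzd p h = coeffwise λ i →
    nzd (coeff p i) (trans (sym (coeff-scale k p i)) (trans (sym (at (mul-const k p) i)) (at h i)))

  DegreeAtMost : List A → ℕ → Set
  DegreeAtMost p s = ∀ d → s ℕ.< d → coeff p d ≈ 0#

  degree-resp : ∀ {p q} s → p ≋ q → DegreeAtMost p s → DegreeAtMost q s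
  degree-resp s h D d s<d = trans (sym (at h d)) (D d s<d)

  degree-mono : ∀ {p s s'} → s ℕ.≤ s' → DegreeAtMost p s → DegreeAtMost p s'
  degree-mono s≤s' D d s'<d = D d (ℕP.≤-<-trans s≤s' s'<d)

  degree-+ : ∀ p q s → DegreeAtMost p s → DegreeAtMost q s → DegreeAtMost (addP p q) s
  degree-+ p q s D E d s<d = trans (coeff-+ p q d) (trans (+-cong (D d s<d) (E d s<d)) (+-identityʳ 0#))

  degree-neg : ∀ p s → DegreeAtMost p s → DegreeAtMost (negP p) s
  degree-neg p s D d s<d = trans (coeff-neg p d) (trans (-‿cong (D d s<d)) -0#≈0#)

  degree-length : ∀ p → DegreeAtMost p (length p)
  degree-length [] d _ = refl
  degree-length (x ∷ p) (suc d) (s≤s l<d) = degree-length p d l<d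

  degree-* : ∀ p q s r → DegreeAtMost p s → DegreeAtMost q r → DegreeAtMost (mulP p q) (s ℕ.+ r)
  degree-* [] q s r D E d _ = refl
  degree-* (x ∷ p) q s r D E d s+r<d =
    trans (coeff-mul-cons x p q d)
          (trans (+-cong (trans (*-congˡ (E d (ℕP.≤-<-trans (ℕP.m≤n+m r s) s+r<d))) (zeroʳ x)) (rest s d D s+r<d))
                 (+-identityʳ 0#))
    where
    rest : ∀ s d → DegreeAtMost (x ∷ p) s → s ℕ.+ r ℕ.< d → coeff (0# ∷ mulP p q) d ≈ 0#
    rest s zero D _ = refl
    rest zero (suc d) D _ = at (mul-zero-left p q (coeffwise λ j → D (suc j) (s≤s z≤n))) d
    rest (suc s) (suc d) D (s≤s s+r<d) = degree-* p q s r (λ j s<j → D (suc j) (s≤s s<j)) E d s+r<d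

  -- topCoeff p s j is the coefficient of x^(s-j) in p (and 0 when j > s):
  -- the coefficients of p read downwards from the nominal top degree s.

  topCoeff : List A → ℕ → ℕ → A
  topCoeff p s zero = coeff p s
  topCoeff p zero (suc j) = 0#
  topCoeff p (suc s) (suc j) = topCoeff p s j

  topCoeff-resp : ∀ {p q} → p ≋ q → ∀ s j → topCoeff p s j ≈ topCoeff q s j
  topCoeff-resp h s zero = at h s
  topCoeff-resp h zero (suc j) = refl
  topCoeff-resp h (suc s) (suc j) = topCoeff-resp h s j

  topCoeff-+ : ∀ p q s j → topCoeff (addP p q) s j ≈ topCoeff p s j + topCoeff q s j
  topCoeff-+ p q s zero = coeff-+ p q s
  topCoeff-+ p q zero (suc j) = sym (+-identityʳ 0#)
  topCoeff-+ p q (suc s) (suc j) = topCoeff-+ p q s j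

  topCoeff-neg : ∀ p s j → topCoeff (negP p) s j ≈ - topCoeff p s j
  topCoeff-neg p s zero = coeff-neg p s
  topCoeff-neg p zero (suc j) = sym -0#≈0#
  topCoeff-neg p (suc s) (suc j) = topCoeff-neg p s j

  topCoeff-scale : ∀ k p s j → topCoeff (map (k *_) p) s j ≈ k * topCoeff p s j
  topCoeff-scale k p s zero = coeff-scale k p s
  topCoeff-scale k p zero (suc j) = sym (zeroʳ k)
  topCoeff-scale k p (suc s) (suc j) = topCoeff-scale k p s j

  topCoeff-[] : ∀ s j → topCoeff [] s j ≈ 0#
  topCoeff-[] s zero = refl
  topCoeff-[] zero (suc j) = refl
  topCoeff-[] (suc s) (suc j) = topCoeff-[] s j

  topCoeff-beyond : ∀ p s j → s ℕ.< j → topCoeff p s j ≈ 0#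
  topCoeff-beyond p zero (suc j) _ = refl
  topCoeff-beyond p (suc s) (suc j) (s≤s s<j) = topCoeff-beyond p s j s<j

  topCoeff-shift : ∀ u s j → topCoeff (0# ∷ u) s j ≈ topCoeff u s (suc j)
  topCoeff-shift u zero zero = refl
  topCoeff-shift u zero (suc j) = refl
  topCoeff-shift u (suc s) zero = refl
  topCoeff-shift u (suc s) (suc j) = topCoeff-shift u s j

  reverse : ℕ → List A → List A
  reverse s p = applyUpTo (topCoeff p s) (suc s)

  coeff-applyUpTo : ∀ n f j → (∀ j → n ℕ.≤ j → f j ≈ 0#) → coeff (applyUpTo f n) j ≈ f j
  coeff-applyUpTo zero f j h = sym (h j z≤n)
  coeff-applyUpTo (suc n) f zero h = refl
  coeff-applyUpTo (suc n) f (suc j) h = coeff-applyUpTo n (λ j → f (suc j)) j (λ j n≤j → h (suc j) (s≤s n≤j))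

  coeff-reverse : ∀ s p j → coeff (reverse s p) j ≈ topCoeff p s j
  coeff-reverse s p j = coeff-applyUpTo (suc s) (topCoeff p s) j (λ j s<j → topCoeff-beyond p s j s<j)

  shift : ℕ → List A → List A
  shift n u = replicate n 0# ++ u

  shift-mul : ∀ n u v → mulP (shift n u) v ≋ shift n (mulP u v)
  shift-mul zero u v = ≋-refl
  shift-mul (suc n) u v = ≋-trans (mul-by-x (shift n u) v) (cons-cong refl (shift-mul n u v))

  shift-cong : ∀ n {u v} → u ≋ v → shift n u ≋ shift n v
  shift-cong zero h = h
  shift-cong (suc n) h = cons-cong refl (shift-cong n h)

  coeff-shift-scale : ∀ n k v j → coeff (shift n (map (k *_) v)) j ≈ k * coeff (shift n v) j
  coeff-shift-scale zero k v j = coeff-scale k v j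
  coeff-shift-scale (suc n) k v zero = sym (zeroʳ k)
  coeff-shift-scale (suc n) k v (suc j) = coeff-shift-scale n k v j

  topCoeff-above : ∀ q r → DegreeAtMost q r → ∀ n j → topCoeff q (n ℕ.+ r) j ≈ coeff (shift n (reverse r q)) j
  topCoeff-above q r D zero j = sym (coeff-reverse r q j)
  topCoeff-above q r D (suc n) zero = D (suc (n ℕ.+ r)) (s≤s (ℕP.m≤n+m r n))
  topCoeff-above q r D (suc n) (suc j) = topCoeff-above q r D n j

  topCoeff-cons : ∀ x p s j → topCoeff (x ∷ p) (suc s) j ≈ topCoeff p s j + coeff (shift (suc s) (const x)) j
  topCoeff-cons x p s zero = sym (+-identityʳ _)
  topCoeff-cons x p s (suc j) = lower s j
    where
    lower : ∀ s j → topCoeff (x ∷ p) s j ≈ topCoeff p s (suc j) + coeff (shift s (const x)) j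
    lower zero zero = sym (+-identityˡ x)
    lower zero (suc j) = sym (+-identityˡ 0#)
    lower (suc s) zero = sym (+-identityʳ _)
    lower (suc s) (suc j) = lower s j

  reverse-cons : ∀ x p s → reverse (suc s) (x ∷ p) ≋ addP (shift (suc s) (const x)) (reverse s p)
  reverse-cons x p s = coeffwise λ j → begin
    coeff (reverse (suc s) (x ∷ p)) j                        ≈⟨ coeff-reverse (suc s) (x ∷ p) j ⟩
    topCoeff (x ∷ p) (suc s) j                               ≈⟨ topCoeff-cons x p s j ⟩
    topCoeff p s j + coeff (shift (suc s) (const x)) j       ≈⟨ +-comm _ _ ⟩
    coeff (shift (suc s) (const x)) j + topCoeff p s j       ≈⟨ +-congˡ (coeff-reverse s p j) ⟨
    coeff (shift (suc s) (const x)) j + coeff (reverse s p) j ≈⟨ coeff-+ (shift (suc s) (const x)) (reverse s p) j ⟨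
    coeff (addP (shift (suc s) (const x)) (reverse s p)) j   ∎

  reverse-[] : ∀ s → reverse s [] ≋ []
  reverse-[] s = coeffwise λ j → trans (coeff-reverse s [] j) (topCoeff-[] s j)

  topCoeff-mul : ∀ p q s r → DegreeAtMost p s → DegreeAtMost q r →
                 ∀ j → topCoeff (mulP p q) (s ℕ.+ r) j ≈ coeff (mulP (reverse s p) (reverse r q)) j
  topCoeff-mul [] q s r D E j =
    trans (topCoeff-[] (s ℕ.+ r) j) (sym (at (mul-zero-left (reverse s []) (reverse r q) (reverse-[] s)) j))
  topCoeff-mul (x ∷ p) q zero r D E j = begin
    topCoeff (mulP (x ∷ p) q) r j               ≈⟨ topCoeff-resp pq≈xq r j ⟩
    topCoeff (map (x *_) q) r j                 ≈⟨ topCoeff-scale x q r j ⟩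
    x * topCoeff q r j                          ≈⟨ *-congˡ (coeff-reverse r q j) ⟨
    x * coeff (reverse r q) j                   ≈⟨ trans (at (mul-const x (reverse r q)) j) (coeff-scale x (reverse r q) j) ⟨
    coeff (mulP (const x) (reverse r q)) j      ∎
    where
    pq≈xq : mulP (x ∷ p) q ≋ map (x *_) q
    pq≈xq = ≋-trans (mul-congˡ {x ∷ p} {const x} q (cons-cong refl (coeffwise λ i → D (suc i) (s≤s z≤n)))) (mul-const x q)
  topCoeff-mul (x ∷ p) q (suc s) r D E j = begin
    topCoeff (addP (map (x *_) q) (0# ∷ mulP p q)) (suc s ℕ.+ r) j
      ≈⟨ topCoeff-+ (map (x *_) q) (0# ∷ mulP p q) (suc s ℕ.+ r) j ⟩
    topCoeff (map (x *_) q) (suc s ℕ.+ r) j + topCoeff (0# ∷ mulP p q) (suc s ℕ.+ r) j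
      ≈⟨ +-cong (trans (topCoeff-scale x q (suc s ℕ.+ r) j) (*-congˡ (topCoeff-above q r E (suc s) j)))
                (trans (topCoeff-shift (mulP p q) (suc s ℕ.+ r) j)
                       (topCoeff-mul p q s r (λ d s<d → D (suc d) (s≤s s<d)) E j)) ⟩
    x * coeff (shift (suc s) (reverse r q)) j + coeff (mulP (reverse s p) (reverse r q)) j
      ≈⟨ +-congʳ (coeff-shift-scale (suc s) x (reverse r q) j) ⟨
    coeff (shift (suc s) (map (x *_) (reverse r q))) j + coeff (mulP (reverse s p) (reverse r q)) j
      ≈⟨ +-congʳ (at (≋-trans (shift-mul (suc s) (const x) (reverse r q)) (shift-cong (suc s) (mul-const x (reverse r q)))) j) ⟨
    coeff (mulP (shift (suc s) (const x)) (reverse r q)) j + coeff (mulP (reverse s p) (reverse r q)) j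
      ≈⟨ coeff-+ (mulP (shift (suc s) (const x)) (reverse r q)) (mulP (reverse s p) (reverse r q)) j ⟨
    coeff (addP (mulP (shift (suc s) (const x)) (reverse r q)) (mulP (reverse s p) (reverse r q))) j
      ≈⟨ at (mul-distribʳ (shift (suc s) (const x)) (reverse s p) (reverse r q)) j ⟨
    coeff (mulP (addP (shift (suc s) (const x)) (reverse s p)) (reverse r q)) j
      ≈⟨ at (mul-congˡ (reverse r q) (reverse-cons x p s)) j ⟨
    coeff (mulP (reverse (suc s) (x ∷ p)) (reverse r q)) j ∎

  coeff-mul₀ : ∀ u v → coeff (mulP u v) 0 ≈ coeff u 0 * coeff v 0
  coeff-mul₀ [] v = sym (zeroˡ _)
  coeff-mul₀ (x ∷ u) v = trans (coeff-mul-cons x u v 0) (+-identityʳ _)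

  coeff-mul₁ : ∀ u v → coeff (mulP u v) 1 ≈ coeff u 0 * coeff v 1 + coeff u 1 * coeff v 0
  coeff-mul₁ [] v = sym (trans (+-cong (zeroˡ _) (zeroˡ _)) (+-identityʳ 0#))
  coeff-mul₁ (x ∷ u) v = trans (coeff-mul-cons x u v 1) (+-congˡ (coeff-mul₀ u v))

  coeff-mul₂ : ∀ u v → coeff (mulP u v) 2 ≈ coeff u 0 * coeff v 2 + coeff u 1 * coeff v 1 + coeff u 2 * coeff v 0
  coeff-mul₂ [] v = sym (trans (+-cong (trans (+-cong (zeroˡ _) (zeroˡ _)) (+-identityʳ 0#)) (zeroˡ _)) (+-identityʳ 0#))
  coeff-mul₂ (x ∷ u) v = trans (coeff-mul-cons x u v 2) (trans (+-congˡ (coeff-mul₁ u v)) (sym (+-assoc _ _ _)))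

  module _ (p q : List A) (s r : ℕ) (D : DegreeAtMost p s) (E : DegreeAtMost q r) where

    private
      product : ∀ i j → coeff (reverse s p) i * coeff (reverse r q) j ≈ topCoeff p s i * topCoeff q r j
      product i j = *-cong (coeff-reverse s p i) (coeff-reverse r q j)

    top-mul₀ : topCoeff (mulP p q) (s ℕ.+ r) 0 ≈ topCoeff p s 0 * topCoeff q r 0
    top-mul₀ = trans (topCoeff-mul p q s r D E 0) (trans (coeff-mul₀ (reverse s p) (reverse r q)) (product 0 0))

    top-mul₁ : topCoeff (mulP p q) (s ℕ.+ r) 1 ≈ topCoeff p s 0 * topCoeff q r 1 + topCoeff p s 1 * topCoeff q r 0
    top-mul₁ = trans (topCoeff-mul p q s r D E 1)
                     (trans (coeff-mul₁ (reverse s p) (reverse r q)) (+-cong (product 0 1) (product 1 0)))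

    top-mul₂ : topCoeff (mulP p q) (s ℕ.+ r) 2 ≈
               topCoeff p s 0 * topCoeff q r 2 + topCoeff p s 1 * topCoeff q r 1 + topCoeff p s 2 * topCoeff q r 0
    top-mul₂ = trans (topCoeff-mul p q s r D E 2)
                     (trans (coeff-mul₂ (reverse s p) (reverse r q))
                            (+-cong (+-cong (product 0 2) (product 1 1)) (product 2 0)))

  monic-degree : ∀ m d u t → DegreeAtMost m d → topCoeff m d 0 ≈ 1# →
                 DegreeAtMost (mulP m u) (d ℕ.+ t) → DegreeAtMost u t
  monic-degree m d u t Dm monic D =
    lower (length u) (degree-mono {u} (ℕP.m≤n+m (length u) t) (degree-length u))
    where
    top-vanishes : ∀ e → t ℕ.< e → DegreeAtMost u e → coeff u e ≈ 0#
    top-vanishes e t<e Du = begin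
      coeff u e                                 ≈⟨ *-identityˡ _ ⟨
      1# * coeff u e                            ≈⟨ *-congʳ monic ⟨
      topCoeff m d 0 * topCoeff u e 0           ≈⟨ top-mul₀ m u d e Dm Du ⟨
      coeff (mulP m u) (d ℕ.+ e)                ≈⟨ D (d ℕ.+ e) (ℕP.+-monoʳ-< d t<e) ⟩
      0#                                        ∎
    step : ∀ k → DegreeAtMost u (t ℕ.+ suc k) → DegreeAtMost u (t ℕ.+ k)
    step k Du e t+k<e with ℕP.m≤n⇒m<n∨m≡n (P.subst (ℕ._≤ e) (P.sym (ℕP.+-suc t k)) t+k<e)
    ... | inj₁ t+1+k<e = Du e t+1+k<e
    ... | inj₂ P.refl = top-vanishes (t ℕ.+ suc k) (ℕP.m<m+n t (s≤s z≤n)) Du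
    lower : ∀ k → DegreeAtMost u (t ℕ.+ k) → DegreeAtMost u t
    lower zero Du = P.subst (DegreeAtMost u) (ℕP.+-identityʳ t) Du
    lower (suc k) Du = lower k (step k Du)

  module TopShapes (κ : ℤ → A)
                   (κ-+ : ∀ z w → κ z + κ w ≈ κ (z ℤ.+ w))
                   (κ-* : ∀ z w → κ z * κ w ≈ κ (z ℤ.* w))
                   (κ-neg : ∀ z → - κ z ≈ κ (ℤ.- z))
                   (a : A) where

    record TopShape (h : List A) (t : ℕ) (c N : ℤ) : Set where
      constructor topShape
      field
        degree : DegreeAtMost h t
        top₀   : topCoeff h t 0 ≈ κ c
        top₁   : topCoeff h t 1 ≈ 0#
        top₂   : κ (+ 60) * topCoeff h t 2 ≈ κ N * a

    TopShape-cast : ∀ {h t c N t' c' N'} → t ≡ t' → c ≡ c' → N ≡ N' → TopShape h t c N → TopShape h t' c' N'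
    TopShape-cast P.refl P.refl P.refl S = S

    TopShape-resp : ∀ {h h' t c N} → h ≋ h' → TopShape h t c N → TopShape h' t c N
    TopShape-resp {t = t} e (topShape D s₀ s₁ s₂) =
      topShape (degree-resp t e D)
               (trans (sym (topCoeff-resp e t 0)) s₀)
               (trans (sym (topCoeff-resp e t 1)) s₁)
               (trans (*-congˡ (sym (topCoeff-resp e t 2))) s₂)

    TopShape-* : ∀ {f g s r c d N M} → TopShape f s c N → TopShape g r d M →
                 TopShape (mulP f g) (s ℕ.+ r) (c ℤ.* d) (c ℤ.* M ℤ.+ d ℤ.* N)
    TopShape-* {f} {g} {s} {r} {c} {d} {N} {M} (topShape Df f₀ f₁ f₂) (topShape Dg g₀ g₁ g₂) =
      topShape (degree-* f g s r Df Dg) top₀ top₁ top₂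
      where
      u v : A
      u = topCoeff f s 2
      v = topCoeff g r 2
      top₀ : topCoeff (mulP f g) (s ℕ.+ r) 0 ≈ κ (c ℤ.* d)
      top₀ = trans (top-mul₀ f g s r Df Dg) (trans (*-cong f₀ g₀) (κ-* c d))
      top₁ : topCoeff (mulP f g) (s ℕ.+ r) 1 ≈ 0#
      top₁ = trans (top-mul₁ f g s r Df Dg)
                   (trans (+-cong (trans (*-congˡ g₁) (zeroʳ _)) (trans (*-congʳ f₁) (zeroˡ _))) (+-identityʳ 0#))
      second : topCoeff (mulP f g) (s ℕ.+ r) 2 ≈ κ c * v + κ d * u
      second = trans (top-mul₂ f g s r Df Dg)
                     (+-cong (trans (+-cong (*-congʳ f₀) (trans (*-congʳ f₁) (zeroˡ _))) (+-identityʳ _))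
                             (trans (*-congˡ g₀) (*-comm u (κ d))))
      top₂ : κ (+ 60) * topCoeff (mulP f g) (s ℕ.+ r) 2 ≈ κ (c ℤ.* M ℤ.+ d ℤ.* N) * a
      top₂ = begin
        κ (+ 60) * topCoeff (mulP f g) (s ℕ.+ r) 2            ≈⟨ *-congˡ second ⟩
        κ (+ 60) * (κ c * v + κ d * u)                         ≈⟨ distribˡ _ _ _ ⟩
        κ (+ 60) * (κ c * v) + κ (+ 60) * (κ d * u)            ≈⟨ +-cong (*-left-comm _ _ v) (*-left-comm _ _ u) ⟩
        κ c * (κ (+ 60) * v) + κ d * (κ (+ 60) * u)            ≈⟨ +-cong (*-congˡ g₂) (*-congˡ f₂) ⟩
        κ c * (κ M * a) + κ d * (κ N * a)                      ≈⟨ +-cong (*-assoc _ _ _) (*-assoc _ _ _) ⟨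
        κ c * κ M * a + κ d * κ N * a                          ≈⟨ distribʳ a _ _ ⟨
        (κ c * κ M + κ d * κ N) * a                            ≈⟨ *-congʳ (trans (+-cong (κ-* c M) (κ-* d N)) (κ-+ _ _)) ⟩
        κ (c ℤ.* M ℤ.+ d ℤ.* N) * a                            ∎

    TopShape-- : ∀ {f g t c d N M} → TopShape f t c N → TopShape g t d M →
                 TopShape (addP f (negP g)) t (c ℤ.- d) (N ℤ.- M)
    TopShape-- {f} {g} {t} {c} {d} {N} {M} (topShape Df f₀ f₁ f₂) (topShape Dg g₀ g₁ g₂) =
      topShape (degree-+ f (negP g) t Df (degree-neg g t Dg)) top₀ top₁ top₂
      where
      difference : ∀ j → topCoeff (addP f (negP g)) t j ≈ topCoeff f t j - topCoeff g t j
      difference j = trans (topCoeff-+ f (negP g) t j) (+-congˡ (topCoeff-neg g t j))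
      top₀ : topCoeff (addP f (negP g)) t 0 ≈ κ (c ℤ.- d)
      top₀ = trans (difference 0) (trans (+-cong f₀ (trans (-‿cong g₀) (κ-neg d))) (κ-+ _ _))
      top₁ : topCoeff (addP f (negP g)) t 1 ≈ 0#
      top₁ = trans (difference 1) (trans (+-cong f₁ (trans (-‿cong g₁) -0#≈0#)) (+-identityʳ 0#))
      top₂ : κ (+ 60) * topCoeff (addP f (negP g)) t 2 ≈ κ (N ℤ.- M) * a
      top₂ = begin
        κ (+ 60) * topCoeff (addP f (negP g)) t 2                ≈⟨ *-congˡ (difference 2) ⟩
        κ (+ 60) * (topCoeff f t 2 - topCoeff g t 2)              ≈⟨ distribˡ _ _ _ ⟩
        κ (+ 60) * topCoeff f t 2 + κ (+ 60) * - topCoeff g t 2   ≈⟨ +-congˡ (-‿distribʳ-* _ _) ⟨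
        κ (+ 60) * topCoeff f t 2 - κ (+ 60) * topCoeff g t 2     ≈⟨ +-cong f₂ (-‿cong g₂) ⟩
        κ N * a - κ M * a                                         ≈⟨ +-congˡ (-‿distribˡ-* _ _) ⟩
        κ N * a + - κ M * a                                       ≈⟨ distribʳ a _ _ ⟨
        (κ N + - κ M) * a                                         ≈⟨ *-congʳ (trans (+-congˡ (κ-neg M)) (κ-+ _ _)) ⟩
        κ (N ℤ.- M) * a                                           ∎

    TopShape-÷ : ∀ {m d K u t c N} → TopShape m d (+ 1) K → κ (+ 1) ≈ 1# →
                 TopShape (mulP m u) (d ℕ.+ t) c (N ℤ.+ c ℤ.* K) → TopShape u t c N
    TopShape-÷ {m} {d} {K} {u} {t} {c} {N} (topShape Dm m₀ m₁ m₂) κ1≈1 (topShape D s₀ s₁ s₂) =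
      topShape Du top₀ top₁ top₂
      where
      monic : topCoeff m d 0 ≈ 1#
      monic = trans m₀ κ1≈1
      Du : DegreeAtMost u t
      Du = monic-degree m d u t Dm monic D
      top₀ : topCoeff u t 0 ≈ κ c
      top₀ = trans (sym (trans (top-mul₀ m u d t Dm Du) (trans (*-congʳ monic) (*-identityˡ _)))) s₀
      first : topCoeff (mulP m u) (d ℕ.+ t) 1 ≈ topCoeff u t 1
      first = trans (top-mul₁ m u d t Dm Du)
                    (trans (+-cong (trans (*-congʳ monic) (*-identityˡ _)) (trans (*-congʳ m₁) (zeroˡ _)))
                           (+-identityʳ _))
      top₁ : topCoeff u t 1 ≈ 0#
      top₁ = trans (sym first) s₁
      second : topCoeff (mulP m u) (d ℕ.+ t) 2 ≈ topCoeff u t 2 + topCoeff m d 2 * topCoeff u t 0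
      second = trans (top-mul₂ m u d t Dm Du)
                     (+-congʳ (trans (+-cong (trans (*-congʳ monic) (*-identityˡ _)) (trans (*-congʳ m₁) (zeroˡ _)))
                                     (+-identityʳ _)))
      top₂ : κ (+ 60) * topCoeff u t 2 ≈ κ N * a
      top₂ = +-cancelʳ (κ c * κ K * a) _ _ (begin
        κ (+ 60) * topCoeff u t 2 + κ c * κ K * a
          ≈⟨ +-congˡ (begin
               κ c * κ K * a                              ≈⟨ *-congʳ (*-comm _ _) ⟩
               κ K * κ c * a                              ≈⟨ *-assoc _ _ _ ⟩
               κ K * (κ c * a)                            ≈⟨ *-congˡ (*-comm _ _) ⟩
               κ K * (a * κ c)                            ≈⟨ *-assoc _ _ _ ⟨
               κ K * a * κ c                              ≈⟨ *-congʳ m₂ ⟨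
               κ (+ 60) * topCoeff m d 2 * κ c            ≈⟨ *-assoc _ _ _ ⟩
               κ (+ 60) * (topCoeff m d 2 * κ c)          ≈⟨ *-congˡ (*-congˡ top₀) ⟨
               κ (+ 60) * (topCoeff m d 2 * topCoeff u t 0) ∎) ⟩
        κ (+ 60) * topCoeff u t 2 + κ (+ 60) * (topCoeff m d 2 * topCoeff u t 0)
          ≈⟨ distribˡ _ _ _ ⟨
        κ (+ 60) * (topCoeff u t 2 + topCoeff m d 2 * topCoeff u t 0)
          ≈⟨ *-congˡ second ⟨
        κ (+ 60) * topCoeff (mulP m u) (d ℕ.+ t) 2
          ≈⟨ s₂ ⟩
        κ (N ℤ.+ c ℤ.* K) * a
          ≈⟨ *-congʳ (trans (+-congˡ (κ-* c K)) (κ-+ N (c ℤ.* K))) ⟨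
        (κ N + κ c * κ K) * a
          ≈⟨ distribʳ a _ _ ⟩
        κ N * a + κ c * κ K * a ∎)

    TopShape-cancel : ∀ {k g t c N} → NonZeroDivisor (κ k) →
                     TopShape (mulP (const (κ k)) g) t (k ℤ.* c) (k ℤ.* N) → TopShape g t c N
    TopShape-cancel {k} {g} {t} {c} {N} nzd (topShape D s₀ s₁ s₂) = topShape Dg top₀ top₁ top₂
      where
      scaled : ∀ j → topCoeff (mulP (const (κ k)) g) t j ≈ κ k * topCoeff g t j
      scaled j = trans (topCoeff-resp (mul-const (κ k) g) t j) (topCoeff-scale (κ k) g t j)
      Dg : DegreeAtMost g t
      Dg d t<d = nzd (coeff g d) (trans (sym (trans (at (mul-const (κ k) g) d) (coeff-scale (κ k) g d))) (D d t<d))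
      top₀ : topCoeff g t 0 ≈ κ c
      top₀ = cancel (κ k) nzd (trans (sym (scaled 0)) (trans s₀ (sym (κ-* k c))))
      top₁ : topCoeff g t 1 ≈ 0#
      top₁ = cancel (κ k) nzd (trans (sym (scaled 1)) (trans s₁ (sym (zeroʳ _))))
      top₂ : κ (+ 60) * topCoeff g t 2 ≈ κ N * a
      top₂ = cancel (κ k) nzd (begin
        κ k * (κ (+ 60) * topCoeff g t 2)     ≈⟨ *-left-comm _ _ _ ⟩
        κ (+ 60) * (κ k * topCoeff g t 2)     ≈⟨ *-congˡ (scaled 2) ⟨
        κ (+ 60) * topCoeff (mulP (const (κ k)) g) t 2 ≈⟨ s₂ ⟩
        κ (k ℤ.* N) * a                       ≈⟨ *-congʳ (κ-* k N) ⟨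
        κ k * κ N * a                         ≈⟨ *-assoc _ _ _ ⟩
        κ k * (κ N * a)                       ∎)

  module Decide (_≟_ : ∀ x y → Dec (x ≈ y)) where

    infix 4 _≋?_
    _≋?_ : ∀ p q → Dec (p ≋ q)
    cons-≋? : ∀ x p y q → Dec ((x ∷ p) ≋ (y ∷ q))

    [] ≋? [] = yes ≋-refl
    [] ≋? (y ∷ q) = map′ (≋-trans []≋[0]) (≋-trans (≋-sym []≋[0])) (cons-≋? 0# [] y q)
    (x ∷ p) ≋? [] = map′ (λ h → ≋-trans h (≋-sym []≋[0])) (λ h → ≋-trans h []≋[0]) (cons-≋? x p 0# [])
    (x ∷ p) ≋? (y ∷ q) = cons-≋? x p y q

    cons-≋? x p y q = map′ (λ (e , h) → cons-cong e h) (λ h → at h 0 , coeffwise λ i → at h (suc i)) ((x ≟ y) ×-dec (p ≋? q))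

  degree-by-drop : ∀ p t → drop (suc t) p ≋ [] → DegreeAtMost p t
  degree-by-drop p t h d t<d = go p (suc t) d h t<d
    where
    go : ∀ p n d → drop n p ≋ [] → n ℕ.≤ d → coeff p d ≈ 0#
    go p zero d h _ = at h d
    go [] (suc n) d h _ = refl
    go (x ∷ p) (suc n) (suc d) h (s≤s n≤d) = go p n d h n≤d

ℤ-ring : IsCommutativeRing (Boxed _≡_) ℤ._+_ ℤ._*_ ℤ.-_ (+ 0) (+ 1)
ℤ-ring = boxed ℤP.+-*-isCommutativeRing

module ℤ[b] = Polynomials ℤops ℤ-ring
module ℤ[a,b] = Polynomials Zbops ℤ[b].polyIsCommutativeRing
module ℤ[a,b][x] = Polynomials Zabops ℤ[a,b].polyIsCommutativeRing

open ℤ[a,b][x] using (DegreeAtMost; topCoeff) renaming (_≋_ to _≈X_)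

module ℤ[a,b]-ring = CommutativeRing ℤ[a,b][x].coeffRing

cAB-* : ∀ z w → cAB z ℤ[a,b]-ring.* cAB w ℤ[a,b]-ring.≈ cAB (z ℤ.* w)
cAB-* z w = ℤ[a,b].≋-trans (ℤ[a,b].const-* (ℤ[b].const z) (ℤ[b].const w))
                           (ℤ[a,b].cons-cong (ℤ[b].const-* z w) ℤ[a,b].≋-refl)

two-nonZeroDivisor : ℤ[a,b][x].NonZeroDivisor (cAB (+ 2))
two-nonZeroDivisor = ℤ[a,b].const-nonZeroDivisor (ℤ[b].const (+ 2)) (ℤ[b].const-nonZeroDivisor (+ 2) in-ℤ)
  where
  in-ℤ : ℤ[b].NonZeroDivisor (+ 2)
  in-ℤ z (box 2z≡0) = box (ℤP.*-cancelˡ-≡ (+ 2) z (+ 0) (P.trans 2z≡0 (P.sym (ℤP.*-zeroʳ (+ 2)))))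

ℤ-≟ : ∀ x y → Dec (Boxed _≡_ x y)
ℤ-≟ x y = map′ box unbox (x ℤ.≟ y)

open ℤ[b].Decide ℤ-≟ using () renaming (_≋?_ to _≟b_)
open ℤ[a,b].Decide _≟b_ using () renaming (_≋?_ to _≟ab_)
open ℤ[a,b][x].Decide _≟ab_ using () renaming (_≋?_ to _≟x_)

by-decision : ∀ {Q : Set} (d : Dec Q) → {True d} → Q
by-decision d {ok} = toWitness ok

open ℤ[a,b][x].TopShapes cAB (λ _ _ → ℤ[a,b]-ring.refl) cAB-* (λ _ → ℤ[a,b]-ring.refl) aAB

-- x³ + a x + b = x³ + (60/60) a x + …
TopShape-Fx : TopShape Fx 3 (+ 1) (+ 60)
TopShape-Fx = topShape degree ℤ[a,b]-ring.refl ℤ[a,b]-ring.refl ℤ[a,b]-ring.refl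
  where
  degree : DegreeAtMost Fx 3
  degree (suc (suc (suc (suc d)))) _ = ℤ[a,b]-ring.refl
  degree 0 ()
  degree 1 (s≤s ())
  degree 2 (s≤s (s≤s ()))
  degree 3 (s≤s (s≤s (s≤s ())))

-- Counting y as an element of degree 3/2, P ∈ R has
-- weighted shape (D, c, M) when P = c x^{D/2} + (M/60) a x^{D/2-2} + … :
--   x-type: P = f with f of top shape (t, c, M), and D = 2t;
--   y-type: P = y g with g of top shape (t, c, M - 30c), and D = 3 + 2t,
-- since y = x^{3/2} (1 + (30/60) a x⁻² + …).

data WShape (P : R) (D c M : ℤ) : Set where
  x-type : ∀ t → D ≡ + (2 ℕ.* t) → proj₂ P ≈X [] → TopShape (proj₁ P) t c M → WShape P D c M
  y-type : ∀ t → D ≡ + (3 ℕ.+ 2 ℕ.* t) → proj₁ P ≈X [] →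
           TopShape (proj₂ P) t c (M ℤ.- + 30 ℤ.* c) → WShape P D c M

WShape-cast : ∀ {P D c M D' c' M'} → D ≡ D' → c ≡ c' → M ≡ M' → WShape P D c M → WShape P D' c' M'
WShape-cast P.refl P.refl P.refl S = S

WShape-resp : ∀ {P Q D c M} → Q ≈R P → WShape P D c M → WShape Q D c M
WShape-resp (e₁ , e₂) (x-type t eq g≈0 S) =
  x-type t eq (ℤ[a,b][x].≋-trans (box e₂) g≈0) (TopShape-resp (ℤ[a,b][x].≋-sym (box e₁)) S)
WShape-resp (e₁ , e₂) (y-type t eq f≈0 S) =
  y-type t eq (ℤ[a,b][x].≋-trans (box e₁) f≈0) (TopShape-resp (ℤ[a,b][x].≋-sym (box e₂)) S)

parity-clash : ∀ s t → + (2 ℕ.* s) ≢ + (3 ℕ.+ 2 ℕ.* t)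
parity-clash s t eq = ℕP.even≢odd s (suc t) (P.trans (ℤP.+-injective eq) (shift t))
  where
  shift : ∀ t → 3 ℕ.+ 2 ℕ.* t ≡ suc (2 ℕ.* suc t)
  shift = ℕ-Solver.solve-∀

x-degree-unique : ∀ {D s r} → D ≡ + (2 ℕ.* s) → D ≡ + (2 ℕ.* r) → r ≡ s
x-degree-unique {s = s} {r} eD eD' = ℕP.*-cancelˡ-≡ r s 2 (ℤP.+-injective (P.trans (P.sym eD') eD))

y-degree-unique : ∀ {D s r} → D ≡ + (3 ℕ.+ 2 ℕ.* s) → D ≡ + (3 ℕ.+ 2 ℕ.* r) → r ≡ s
y-degree-unique {s = s} {r} eD eD' =
  ℕP.*-cancelˡ-≡ r s 2 (ℕP.+-cancelˡ-≡ 3 _ _ (ℤP.+-injective (P.trans (P.sym eD') eD)))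

degree-sum : ∀ {D E a b c} → D ≡ + a → E ≡ + b → a ℕ.+ b ≡ c → D ℤ.+ E ≡ + c
degree-sum P.refl P.refl P.refl = P.refl

module _ where
  open ℤ[a,b][x] using (≋-refl; ≋-trans; ≋-sym; mul-zero-left; mul-congˡ; mul-congʳ; *-vanishingʳ; +-vanishingʳ; +-vanishingˡ; neg-cong-P; const; const-nonZeroDivisor)

  WShape-* : ∀ {P Q D E c d M N} → WShape P D c M → WShape Q E d N →
             WShape (P *R Q) (D ℤ.+ E) (c ℤ.* d) (c ℤ.* N ℤ.+ d ℤ.* M)
  WShape-* {f , g} {f' , g'} {c = c} {d} {M} {N} (x-type s eD g≈0 S) (x-type r eE g'≈0 S') =
    x-type (s ℕ.+ r) (degree-sum eD eE (P.sym (ℕP.*-distribˡ-+ 2 s r)))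
      (≋-trans (+-vanishingʳ (f XAB.* g') (mul-zero-left g f' g≈0)) (*-vanishingʳ f g'≈0))
      (TopShape-resp (≋-sym (+-vanishingʳ (f XAB.* f') (*-vanishingʳ Fx (mul-zero-left g g' g≈0)))) (TopShape-* S S'))
  WShape-* {f , g} {f' , g'} {c = c} {d} {M} {N} (x-type s eD g≈0 S) (y-type r eE f'≈0 S') =
    y-type (s ℕ.+ r) (degree-sum eD eE (degrees s r))
      (≋-trans (+-vanishingʳ (f XAB.* f') (*-vanishingʳ Fx (mul-zero-left g g' g≈0))) (*-vanishingʳ f f'≈0))
      (TopShape-cast P.refl P.refl (second c d M N)
        (TopShape-resp (≋-sym (+-vanishingʳ (f XAB.* g') (mul-zero-left g f' g≈0))) (TopShape-* S S')))
    where
    degrees : ∀ s r → 2 ℕ.* s ℕ.+ (3 ℕ.+ 2 ℕ.* r) ≡ 3 ℕ.+ 2 ℕ.* (s ℕ.+ r)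
    degrees = ℕ-Solver.solve-∀
    second : ∀ c d M N → c ℤ.* (N ℤ.- + 30 ℤ.* d) ℤ.+ d ℤ.* M ≡ c ℤ.* N ℤ.+ d ℤ.* M ℤ.- + 30 ℤ.* (c ℤ.* d)
    second = solve-∀
  WShape-* {f , g} {f' , g'} {c = c} {d} {M} {N} (y-type s eD f≈0 S) (x-type r eE g'≈0 S') =
    y-type (s ℕ.+ r) (degree-sum eD eE (degrees s r))
      (≋-trans (+-vanishingʳ (f XAB.* f') (*-vanishingʳ Fx (*-vanishingʳ g g'≈0))) (mul-zero-left f f' f≈0))
      (TopShape-cast P.refl P.refl (second c d M N)
        (TopShape-resp (≋-sym (+-vanishingˡ (g XAB.* f') (mul-zero-left f g' f≈0))) (TopShape-* S S')))
    where
    degrees : ∀ s r → 3 ℕ.+ 2 ℕ.* s ℕ.+ 2 ℕ.* r ≡ 3 ℕ.+ 2 ℕ.* (s ℕ.+ r)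
    degrees = ℕ-Solver.solve-∀
    second : ∀ c d M N → c ℤ.* N ℤ.+ d ℤ.* (M ℤ.- + 30 ℤ.* c) ≡ c ℤ.* N ℤ.+ d ℤ.* M ℤ.- + 30 ℤ.* (c ℤ.* d)
    second = solve-∀
  WShape-* {f , g} {f' , g'} {c = c} {d} {M} {N} (y-type s eD f≈0 S) (y-type r eE f'≈0 S') =
    x-type (3 ℕ.+ (s ℕ.+ r)) (degree-sum eD eE (degrees s r))
      (≋-trans (+-vanishingˡ (g XAB.* f') (mul-zero-left f g' f≈0)) (*-vanishingʳ g f'≈0))
      (TopShape-cast P.refl (ℤP.*-identityˡ (c ℤ.* d)) (second c d M N)
        (TopShape-resp (≋-sym (+-vanishingˡ (Fx XAB.* (g XAB.* g')) (mul-zero-left f f' f≈0)))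
          (TopShape-* TopShape-Fx (TopShape-* S S'))))
    where
    -- y · y = x³ + a x + b
    degrees : ∀ s r → 3 ℕ.+ 2 ℕ.* s ℕ.+ (3 ℕ.+ 2 ℕ.* r) ≡ 2 ℕ.* (3 ℕ.+ (s ℕ.+ r))
    degrees = ℕ-Solver.solve-∀
    second : ∀ c d M N → + 1 ℤ.* (c ℤ.* (N ℤ.- + 30 ℤ.* d) ℤ.+ d ℤ.* (M ℤ.- + 30 ℤ.* c)) ℤ.+ c ℤ.* d ℤ.* + 60
                         ≡ c ℤ.* N ℤ.+ d ℤ.* M
    second = solve-∀

  WShape-- : ∀ {P Q D c d M N} → WShape P D c M → WShape Q D d N → WShape (P -R Q) D (c ℤ.- d) (M ℤ.- N)
  WShape-- {f , g} {f' , g'} (x-type s eD g≈0 S) (x-type r eD' g'≈0 S') =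
    x-type s eD (≋-trans (+-vanishingʳ g (neg-cong-P g'≈0)) g≈0) (TopShape-- S (TopShape-cast (x-degree-unique eD eD') P.refl P.refl S'))
  WShape-- {f , g} {f' , g'} {c = c} {d} {M} {N} (y-type s eD f≈0 S) (y-type r eD' f'≈0 S') =
    y-type s eD (≋-trans (+-vanishingʳ f (neg-cong-P f'≈0)) f≈0)
      (TopShape-cast P.refl P.refl (second c d M N) (TopShape-- S (TopShape-cast (y-degree-unique eD eD') P.refl P.refl S')))
    where
    second : ∀ c d M N → M ℤ.- + 30 ℤ.* c ℤ.- (N ℤ.- + 30 ℤ.* d) ≡ M ℤ.- N ℤ.- + 30 ℤ.* (c ℤ.- d)
    second = solve-∀
  WShape-- (x-type s eD _ _) (y-type r eD' _ _) = ⊥-elim (parity-clash s r (P.trans (P.sym eD) eD'))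
  WShape-- (y-type s eD _ _) (x-type r eD' _ _) = ⊥-elim (parity-clash r s (P.trans (P.sym eD') eD))

  WShape-one : WShape (constR (+ 1)) (+ 0) (+ 1) (+ 0)
  WShape-one = x-type 0 P.refl ≋-refl (topShape degree ℤ[a,b]-ring.refl ℤ[a,b]-ring.refl (by-decision (_ ≟ab _)))
    where
    degree : DegreeAtMost (proj₁ (constR (+ 1))) 0
    degree (suc d) _ = ℤ[a,b]-ring.refl

  WShape-^ : ∀ {P D c M} → WShape P D c M → ∀ k →
             WShape (P ^R k) (+ k ℤ.* D) (c ℤ.^ k) (+ k ℤ.* c ℤ.^ (k ℕ.∸ 1) ℤ.* M)
  WShape-^ {D = D} {c} {M} W zero = WShape-cast (P.sym (ℤP.*-zeroˡ D)) P.refl (no-second M) WShape-one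
    where
    no-second : ∀ M → + 0 ≡ + 0 ℤ.* + 1 ℤ.* M
    no-second = solve-∀
  WShape-^ {D = D} {c} {M} W (suc k) = WShape-cast (degree D (+ k)) P.refl (second k) (WShape-* W (WShape-^ W k))
    where
    degree : ∀ D K → D ℤ.+ K ℤ.* D ≡ (+ 1 ℤ.+ K) ℤ.* D
    degree = solve-∀
    second₀ : ∀ c M → c ℤ.* (+ 0 ℤ.* + 1 ℤ.* M) ℤ.+ + 1 ℤ.* M ≡ + 1 ℤ.* + 1 ℤ.* M
    second₀ = solve-∀
    second₊ : ∀ c p M K → c ℤ.* ((+ 1 ℤ.+ K) ℤ.* p ℤ.* M) ℤ.+ c ℤ.* p ℤ.* M ≡ (+ 2 ℤ.+ K) ℤ.* (c ℤ.* p) ℤ.* M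
    second₊ = solve-∀
    second : ∀ k → c ℤ.* (+ k ℤ.* c ℤ.^ (k ℕ.∸ 1) ℤ.* M) ℤ.+ c ℤ.^ k ℤ.* M ≡ + suc k ℤ.* c ℤ.^ k ℤ.* M
    second zero = second₀ c M
    second (suc k) = second₊ c (c ℤ.^ k) M (+ k)

  doubled-degree : ∀ {D t} → D ≡ + (3 ℕ.+ 2 ℕ.* t) → + 3 ℤ.+ D ≡ + (2 ℕ.* (3 ℕ.+ t))
  doubled-degree {t = t} P.refl = P.cong +_ (ℕ-Solver.solve (t ∷ []))

  WShape-÷2y : ∀ {P Q D c M} t → (+ 2) ·R Y *R P ≈R Q → D ≡ + (3 ℕ.+ 2 ℕ.* t) →
               WShape Q (+ 3 ℤ.+ D) (+ 2 ℤ.* c) (+ 2 ℤ.* M ℤ.+ + 60 ℤ.* c) → WShape P D c M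
  WShape-÷2y {f , g} {Q} {D} {c} {M} t (e₁ , e₂) eD (x-type tQ eQ gQ≈0 S) =
    y-type t eD f≈0
      (TopShape-cancel {k = + 2} {g = g} two-nonZeroDivisor
        (TopShape-÷ {u = two XAB.* g} {t = t} TopShape-Fx ℤ[a,b]-ring.refl
          (TopShape-cast (x-degree-unique {s = 3 ℕ.+ t} {r = tQ} (doubled-degree {t = t} eD) eQ) P.refl (second c M)
            (TopShape-resp Q₁≈ S))))
    where
    two : Zxab
    two = const (cAB (+ 2))
    z₁≈0 : proj₁ ((+ 2) ·R Y) ≈X []
    z₁≈0 = by-decision (_ ≟x _)
    z₂≈2 : proj₂ ((+ 2) ·R Y) ≈X two
    z₂≈2 = by-decision (_ ≟x _)
    2f≈0 : two XAB.* f ≈X []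
    2f≈0 = ≋-trans (mul-congˡ f (≋-sym z₂≈2))
             (≋-trans (≋-sym (+-vanishingˡ (proj₂ ((+ 2) ·R Y) XAB.* f) (mul-zero-left _ g z₁≈0)))
               (≋-trans (box e₂) gQ≈0))
    f≈0 : f ≈X []
    f≈0 = const-nonZeroDivisor (cAB (+ 2)) two-nonZeroDivisor f 2f≈0
    Q₁≈ : proj₁ Q ≈X Fx XAB.* (two XAB.* g)
    Q₁≈ = ≋-trans (≋-sym (box e₁))
            (≋-trans (+-vanishingˡ (Fx XAB.* (proj₂ ((+ 2) ·R Y) XAB.* g)) (mul-zero-left _ f z₁≈0))
              (mul-congʳ Fx (mul-congˡ g z₂≈2)))
    second : ∀ c M → + 2 ℤ.* M ℤ.+ + 60 ℤ.* c ≡ + 2 ℤ.* (M ℤ.- + 30 ℤ.* c) ℤ.+ + 2 ℤ.* c ℤ.* + 60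
    second = solve-∀
  WShape-÷2y {D = D} t _ eD (y-type tQ eQ _ _) =
    ⊥-elim (parity-clash (3 ℕ.+ t) tQ (P.trans (P.sym (doubled-degree eD)) eQ))


Expected : R → ℤ → Set
Expected P x = WShape P (x ℤ.* x ℤ.- + 1) x (x ℤ.* (x ℤ.* x ℤ.- + 1) ℤ.* (x ℤ.* x ℤ.+ + 6))

Expected-cast : ∀ {P x y} → x ≡ y → Expected P x → Expected P y
Expected-cast P.refl E = E

-- The polynomial identities in x = m behind the recurrences: D is the weighted
-- degree, W the second coefficient, and powers are written as the products they
-- compute to.  (Local definitions are let-bound so that the ring solver sees
-- through them.)
module Identities where
  odd-D₁ : ∀ x → let D : ℤ → ℤ
                     D y = y ℤ.* y ℤ.- + 1
                 in D (x ℤ.+ + 2) ℤ.+ + 3 ℤ.* D x ≡ D (+ 2 ℤ.* x ℤ.+ + 1)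
  odd-D₁ = solve-∀

  odd-D₂ : ∀ x → let D : ℤ → ℤ
                     D y = y ℤ.* y ℤ.- + 1
                 in D (x ℤ.- + 1) ℤ.+ + 3 ℤ.* D (x ℤ.+ + 1) ≡ D (+ 2 ℤ.* x ℤ.+ + 1)
  odd-D₂ = solve-∀

  odd-c : ∀ x → let cube : ℤ → ℤ
                    cube y = y ℤ.* (y ℤ.* (y ℤ.* + 1))
                in (x ℤ.+ + 2) ℤ.* cube x ℤ.- (x ℤ.- + 1) ℤ.* cube (x ℤ.+ + 1) ≡ + 2 ℤ.* x ℤ.+ + 1
  odd-c = solve-∀

  odd-W : ∀ x → let W : ℤ → ℤ
                    W y = y ℤ.* (y ℤ.* y ℤ.- + 1) ℤ.* (y ℤ.* y ℤ.+ + 6)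
                    square : ℤ → ℤ
                    square y = y ℤ.* (y ℤ.* + 1)
                    cube : ℤ → ℤ
                    cube y = y ℤ.* square y
                in (x ℤ.+ + 2) ℤ.* (+ 3 ℤ.* square x ℤ.* W x) ℤ.+ cube x ℤ.* W (x ℤ.+ + 2)
                   ℤ.- ((x ℤ.- + 1) ℤ.* (+ 3 ℤ.* square (x ℤ.+ + 1) ℤ.* W (x ℤ.+ + 1))
                        ℤ.+ cube (x ℤ.+ + 1) ℤ.* W (x ℤ.- + 1))
                   ≡ W (+ 2 ℤ.* x ℤ.+ + 1)
  odd-W = solve-∀

  even-D : ∀ x → let D : ℤ → ℤ
                     D y = y ℤ.* y ℤ.- + 1
                 in D (x ℤ.- + 2) ℤ.+ + 2 ℤ.* D (x ℤ.+ + 1) ≡ D (x ℤ.+ + 2) ℤ.+ + 2 ℤ.* D (x ℤ.- + 1)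
  even-D = solve-∀

  even-D' : ∀ x → let D : ℤ → ℤ
                      D y = y ℤ.* y ℤ.- + 1
                  in D x ℤ.+ (D (x ℤ.+ + 2) ℤ.+ + 2 ℤ.* D (x ℤ.- + 1)) ≡ + 3 ℤ.+ D (+ 2 ℤ.* x)
  even-D' = solve-∀

  even-c : ∀ x → let square : ℤ → ℤ
                     square y = y ℤ.* (y ℤ.* + 1)
                 in x ℤ.* ((x ℤ.+ + 2) ℤ.* square (x ℤ.- + 1) ℤ.- (x ℤ.- + 2) ℤ.* square (x ℤ.+ + 1))
                    ≡ + 2 ℤ.* (+ 2 ℤ.* x)
  even-c = solve-∀

  even-W : ∀ x → let W : ℤ → ℤ
                     W y = y ℤ.* (y ℤ.* y ℤ.- + 1) ℤ.* (y ℤ.* y ℤ.+ + 6)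
                     square : ℤ → ℤ
                     square y = y ℤ.* (y ℤ.* + 1)
                 in x ℤ.* ((x ℤ.+ + 2) ℤ.* (+ 2 ℤ.* ((x ℤ.- + 1) ℤ.* + 1) ℤ.* W (x ℤ.- + 1))
                           ℤ.+ square (x ℤ.- + 1) ℤ.* W (x ℤ.+ + 2)
                           ℤ.- ((x ℤ.- + 2) ℤ.* (+ 2 ℤ.* ((x ℤ.+ + 1) ℤ.* + 1) ℤ.* W (x ℤ.+ + 1))
                                ℤ.+ square (x ℤ.+ + 1) ℤ.* W (x ℤ.- + 2)))
                    ℤ.+ ((x ℤ.+ + 2) ℤ.* square (x ℤ.- + 1) ℤ.- (x ℤ.- + 2) ℤ.* square (x ℤ.+ + 1)) ℤ.* W x
                    ≡ + 2 ℤ.* W (+ 2 ℤ.* x) ℤ.+ + 60 ℤ.* (+ 2 ℤ.* x)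
  even-W = solve-∀

square-odd : ∀ k → (2 ℕ.* k ℕ.+ 1) ℕ.* (2 ℕ.* k ℕ.+ 1) ≡ suc (2 ℕ.* (2 ℕ.* k ℕ.* (k ℕ.+ 1)))
square-odd = ℕ-Solver.solve-∀

square-even : ∀ k → (2 ℕ.* suc k) ℕ.* (2 ℕ.* suc k) ≡ suc (3 ℕ.+ 2 ℕ.* (2 ℕ.* k ℕ.* (k ℕ.+ 2)))
square-even = ℕ-Solver.solve-∀

weighted-degree : ∀ n X → n ℕ.* n ≡ suc X → + n ℤ.* + n ℤ.- + 1 ≡ + X
weighted-degree n X eq = P.trans (P.cong (ℤ._- + 1) (P.sym (ℤP.pos-* n n))) (P.cong (λ y → + y ℤ.- + 1) eq)

decide-TopShape : ∀ h t c N →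
  {True (drop (suc t) h ≟x [])} → {True (topCoeff h t 0 ≟ab cAB c)} →
  {True (topCoeff h t 1 ≟ab ℤ[a,b]-ring.0#)} → {True (cAB (+ 60) ℤ[a,b]-ring.* topCoeff h t 2 ≟ab cAB N ℤ[a,b]-ring.* aAB)} →
  TopShape h t c N
decide-TopShape h t c N {d} {t₀} {t₁} {t₂} =
  topShape (ℤ[a,b][x].degree-by-drop h t (toWitness d)) (toWitness t₀) (toWitness t₁) (toWitness t₂)

data LargeIndex (n : ℕ) : Set where
  odd-index  : ∀ j → n ≡ 2 ℕ.* (2 ℕ.+ j) ℕ.+ 1 → LargeIndex n
  even-index : ∀ j → n ≡ 2 ℕ.* (3 ℕ.+ j) → LargeIndex n

large-index : ∀ l → LargeIndex (5 ℕ.+ l)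
large-index zero = odd-index 0 P.refl
large-index (suc zero) = even-index 0 P.refl
large-index (suc (suc l)) with large-index l
... | odd-index j eq = odd-index (suc j) (P.trans (P.cong (2 ℕ.+_) eq) (next-odd j))
  where
  next-odd : ∀ j → 2 ℕ.+ (2 ℕ.* (2 ℕ.+ j) ℕ.+ 1) ≡ 2 ℕ.* (2 ℕ.+ suc j) ℕ.+ 1
  next-odd = ℕ-Solver.solve-∀
... | even-index j eq = even-index (suc j) (P.trans (P.cong (2 ℕ.+_) eq) (next-even j))
  where
  next-even : ∀ j → 2 ℕ.+ 2 ℕ.* (3 ℕ.+ j) ≡ 2 ℕ.* (3 ℕ.+ suc j)
  next-even = ℕ-Solver.solve-∀

module Recurrences (ψ : ℕ → R) (H : IsDivisionPolynomials ψ) where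
  open IsDivisionPolynomials H
  open Identities

  odd-step : ∀ m → 2 ℕ.≤ m → let x = + m in
             Expected (ψ (m ℕ.+ 2)) (x ℤ.+ + 2) → Expected (ψ m) x →
             Expected (ψ (m ℕ.∸ 1)) (x ℤ.- + 1) → Expected (ψ (m ℕ.+ 1)) (x ℤ.+ + 1) →
             Expected (ψ (2 ℕ.* m ℕ.+ 1)) (+ 2 ℤ.* x ℤ.+ + 1)
  odd-step m 2≤m E₊₂ E₀ E₋₁ E₊₁ =
    WShape-resp (ψ-odd m 2≤m)
      (WShape-cast P.refl (odd-c x) (odd-W x)
        (WShape-- (WShape-cast (odd-D₁ x) P.refl P.refl (WShape-* E₊₂ (WShape-^ E₀ 3)))
                  (WShape-cast (odd-D₂ x) P.refl P.refl (WShape-* E₋₁ (WShape-^ E₊₁ 3)))))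
    where
    x : ℤ
    x = + m

  even-step : ∀ k → 3 ℕ.≤ suc k → let m = suc k ; x = + m in
              Expected (ψ (m ℕ.+ 2)) (x ℤ.+ + 2) → Expected (ψ m) x →
              Expected (ψ (m ℕ.∸ 1)) (x ℤ.- + 1) → Expected (ψ (m ℕ.∸ 2)) (x ℤ.- + 2) →
              Expected (ψ (m ℕ.+ 1)) (x ℤ.+ + 1) →
              Expected (ψ (2 ℕ.* m)) (+ 2 ℤ.* x)
  even-step k 3≤m E₊₂ E₀ E₋₁ E₋₂ E₊₁ =
    WShape-÷2y (2 ℕ.* k ℕ.* (k ℕ.+ 2)) (ψ-even m 3≤m) degree
      (WShape-cast (even-D' x) (even-c x) (even-W x)
        (WShape-* E₀ (WShape-- (WShape-* E₊₂ (WShape-^ E₋₁ 2))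
                               (WShape-cast (even-D x) P.refl P.refl (WShape-* E₋₂ (WShape-^ E₊₁ 2))))))
    where
    m : ℕ
    m = suc k
    x : ℤ
    x = + m
    degree : (+ 2 ℤ.* x) ℤ.* (+ 2 ℤ.* x) ℤ.- + 1 ≡ + (3 ℕ.+ 2 ℕ.* (2 ℕ.* k ℕ.* (k ℕ.+ 2)))
    degree = P.trans (P.cong (λ y → y ℤ.* y ℤ.- + 1) (P.sym (ℤP.pos-* 2 m))) (weighted-degree (2 ℕ.* m) _ (square-even k))

  ψ₃-formula : R
  ψ₃-formula = (+ 3) ·R X ^R 4 +R (+ 6) ·R A *R X ^R 2 +R (+ 12) ·R B *R X -R A ^R 2

  ψ₄-formula : R
  ψ₄-formula = (+ 4) ·R Y *R
               (X ^R 6 +R (+ 5) ·R A *R X ^R 4 +R (+ 20) ·R B *R X ^R 3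
                -R (+ 5) ·R A ^R 2 *R X ^R 2 -R (+ 4) ·R A *R B *R X
                -R (+ 8) ·R B ^R 2 -R A ^R 3)

  base₁ : Expected (ψ 1) (+ 1)
  base₁ = WShape-resp ψ₁ WShape-one

  base₂ : Expected (ψ 2) (+ 2)
  base₂ = WShape-resp {P = (+ 2) ·R Y} ψ₂ (y-type 0 P.refl (by-decision (_ ≟x _)) (decide-TopShape _ 0 (+ 2) (+ 0)))

  base₃ : Expected (ψ 3) (+ 3)
  base₃ = WShape-resp {P = ψ₃-formula} ψ₃ (x-type 4 P.refl (by-decision (_ ≟x _)) (decide-TopShape _ 4 (+ 3) (+ 360)))

  base₄ : Expected (ψ 4) (+ 4)
  base₄ = WShape-resp {P = ψ₄-formula} ψ₄ (y-type 6 P.refl (by-decision (_ ≟x _)) (decide-TopShape _ 6 (+ 4) (+ 1200)))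

  expected : ∀ n → 1 ℕ.≤ n → Expected (ψ n) (+ n)
  expected = <-rec (λ n → 1 ℕ.≤ n → Expected (ψ n) (+ n)) shape
    where
    Target : ℕ → Set
    Target n = Expected (ψ n) (+ n)
    up-to : ∀ {n} m → m ℕ.+ 2 ℕ.< n → (∀ {k} → k ℕ.< n → 1 ℕ.≤ k → Target k) →
            ∀ k → k ℕ.≤ m ℕ.+ 2 → 1 ℕ.≤ k → Target k
    up-to m bound rec k k≤m+2 = rec (ℕP.≤-<-trans k≤m+2 bound)
    <-by : ∀ a b c → suc a ℕ.+ c ≡ b → a ℕ.< b
    <-by a b c eq = P.subst (suc a ℕ.≤_) eq (ℕP.m≤m+n (suc a) c)
    odd-room : ∀ j → suc (2 ℕ.+ j ℕ.+ 2) ℕ.+ j ≡ 2 ℕ.* (2 ℕ.+ j) ℕ.+ 1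
    odd-room = ℕ-Solver.solve-∀
    even-room : ∀ j → suc (3 ℕ.+ j ℕ.+ 2) ℕ.+ j ≡ 2 ℕ.* (3 ℕ.+ j)
    even-room = ℕ-Solver.solve-∀
    shape : ∀ n → (∀ {k} → k ℕ.< n → 1 ℕ.≤ k → Target k) → 1 ℕ.≤ n → Target n
    shape 1 _ _ = base₁
    shape 2 _ _ = base₂
    shape 3 _ _ = base₃
    shape 4 _ _ = base₄
    shape (suc (suc (suc (suc (suc l))))) rec _ with large-index l
    ... | odd-index j eq = P.subst Target (P.sym eq) (Expected-cast index
            (odd-step m (s≤s (s≤s z≤n)) (at (m ℕ.+ 2) ℕP.≤-refl (s≤s z≤n)) (at m (ℕP.m≤m+n m 2) (s≤s z≤n))
                      (at (suc j) (ℕP.≤-trans (ℕP.n≤1+n (suc j)) (ℕP.m≤m+n m 2)) (s≤s z≤n))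
                      (at (m ℕ.+ 1) (ℕP.+-monoʳ-≤ m (s≤s z≤n)) (s≤s z≤n))))
      where
      m : ℕ
      m = 2 ℕ.+ j
      at : ∀ k → k ℕ.≤ m ℕ.+ 2 → 1 ℕ.≤ k → Target k
      at = up-to m (P.subst (m ℕ.+ 2 ℕ.<_) (P.sym eq) (<-by (m ℕ.+ 2) (2 ℕ.* m ℕ.+ 1) j (odd-room j))) rec
      index : + 2 ℤ.* + m ℤ.+ + 1 ≡ + (2 ℕ.* m ℕ.+ 1)
      index = P.sym (P.trans (ℤP.pos-+ (2 ℕ.* m) 1) (P.cong (ℤ._+ + 1) (ℤP.pos-* 2 m)))
    ... | even-index j eq = P.subst Target (P.sym eq) (Expected-cast index
            (even-step (2 ℕ.+ j) (s≤s (s≤s (s≤s z≤n))) (at (m ℕ.+ 2) ℕP.≤-refl (s≤s z≤n)) (at m (ℕP.m≤m+n m 2) (s≤s z≤n))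
                       (at (2 ℕ.+ j) (ℕP.≤-trans (ℕP.n≤1+n (2 ℕ.+ j)) (ℕP.m≤m+n m 2)) (s≤s z≤n))
                       (at (suc j) (ℕP.≤-trans (ℕP.m≤n⇒m≤1+n (ℕP.n≤1+n (suc j))) (ℕP.m≤m+n m 2)) (s≤s z≤n))
                       (at (m ℕ.+ 1) (ℕP.+-monoʳ-≤ m (s≤s z≤n)) (s≤s z≤n))))
      where
      m : ℕ
      m = 3 ℕ.+ j
      at : ∀ k → k ℕ.≤ m ℕ.+ 2 → 1 ℕ.≤ k → Target k
      at = up-to m (P.subst (m ℕ.+ 2 ℕ.<_) (P.sym eq) (<-by (m ℕ.+ 2) (2 ℕ.* m) j (even-room j))) rec
      index : + 2 ℤ.* + m ≡ + (2 ℕ.* m)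
      index = P.sym (ℤP.pos-* 2 m)

to-LeadingShape : ∀ {h t c N} → TopShape h t c N → LeadingShape h t c N
to-LeadingShape {h} {t} {c} {N} (topShape D s₀ s₁ s₂) = (λ d t<d → unbox (D d t<d)) , unbox s₀ , first t s₁ , second t s₂
  where
  first : ∀ t → topCoeff h t 1 ℤ[a,b]-ring.≈ ℤ[a,b]-ring.0# → 1 ℕ.≤ t → coeffX h (t ℕ.∸ 1) AB.≈ AB.0#
  first (suc t) e _ = unbox e
  first zero e ()
  second : ∀ t → cAB (+ 60) ℤ[a,b]-ring.* topCoeff h t 2 ℤ[a,b]-ring.≈ cAB N ℤ[a,b]-ring.* aAB →
           2 ℕ.≤ t → (cAB (+ 60) AB.* coeffX h (t ℕ.∸ 2)) AB.≈ (cAB N AB.* aAB)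
  second (suc (suc t)) e _ = unbox e
  second (suc zero) e (s≤s ())
  second zero e ()

half-of-double : ∀ t → ⌊ 2 ℕ.* t /2⌋ ≡ t
half-of-double t = P.sym (P.trans (ℕP.n≡⌊n+n/2⌋ t) (P.cong ⌊_/2⌋ (P.cong (t ℕ.+_) (P.sym (ℕP.+-identityʳ t)))))

read-odd : ∀ {P} k → let n = 2 ℕ.* k ℕ.+ 1 in Expected P (+ n) →
           (proj₂ P XAB.≈ XAB.0#) × LeadingShape (proj₁ P) (oddTop n) (+ n) (oddN n)
read-odd k (x-type t eD g≈0 S) =
  unbox g≈0 , to-LeadingShape (TopShape-cast top P.refl second S)
  where
  n T : ℕ
  n = 2 ℕ.* k ℕ.+ 1
  T = 2 ℕ.* k ℕ.* (k ℕ.+ 1)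
  top : t ≡ oddTop n
  top = P.trans (x-degree-unique {s = T} {r = t} (weighted-degree n _ (square-odd k)) eD)
                (P.sym (P.trans (P.cong (λ y → ⌊ y ℕ.∸ 1 /2⌋) (square-odd k)) (half-of-double T)))
  second : + n ℤ.* (+ n ℤ.* + n ℤ.- + 1) ℤ.* (+ n ℤ.* + n ℤ.+ + 6) ≡ oddN n
  second = P.cong (λ y → + n ℤ.* (y ℤ.- + 1) ℤ.* (y ℤ.+ + 6)) (P.sym (ℤP.pos-* n n))
read-odd k (y-type t eD _ _) =
  ⊥-elim (parity-clash (2 ℕ.* k ℕ.* (k ℕ.+ 1)) t (P.trans (P.sym (weighted-degree (2 ℕ.* k ℕ.+ 1) _ (square-odd k))) eD))

read-even : ∀ {P} k → let n = 2 ℕ.* suc k in Expected P (+ n) →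
            (proj₁ P XAB.≈ XAB.0#) × LeadingShape (proj₂ P) (evenTop n) (+ n) (evenN n)
read-even k (y-type t eD f≈0 S) =
  unbox f≈0 , to-LeadingShape (TopShape-cast top P.refl second S)
  where
  n T : ℕ
  n = 2 ℕ.* suc k
  T = 2 ℕ.* k ℕ.* (k ℕ.+ 2)
  top : t ≡ evenTop n
  top = P.trans (y-degree-unique {s = T} {r = t} (weighted-degree n _ (square-even k)) eD)
                (P.sym (P.trans (P.cong (λ y → ⌊ y ℕ.∸ 4 /2⌋) (square-even k)) (half-of-double T)))
  second-form : ∀ x y → x ℤ.* (y ℤ.- + 1) ℤ.* (y ℤ.+ + 6) ℤ.- + 30 ℤ.* x ≡ x ℤ.* ((y ℤ.- + 1) ℤ.* (y ℤ.+ + 6) ℤ.- + 30)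
  second-form = solve-∀
  second : + n ℤ.* (+ n ℤ.* + n ℤ.- + 1) ℤ.* (+ n ℤ.* + n ℤ.+ + 6) ℤ.- + 30 ℤ.* + n ≡ evenN n
  second = P.trans (P.cong (λ y → + n ℤ.* (y ℤ.- + 1) ℤ.* (y ℤ.+ + 6) ℤ.- + 30 ℤ.* + n) (P.sym (ℤP.pos-* n n)))
                   (second-form (+ n) (+ (n ℕ.* n)))
read-even k (x-type t eD _ _) =
  ⊥-elim (parity-clash t (2 ℕ.* k ℕ.* (k ℕ.+ 2)) (P.trans (P.sym eD) (weighted-degree (2 ℕ.* suc k) _ (square-even k))))

lemma1 : (ψ : ℕ → R) → IsDivisionPolynomials ψ →
         ((k : ℕ) → let n = 2 ℕ.* k ℕ.+ 1 in
            (proj₂ (ψ n) XAB.≈ XAB.0#) ×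
            LeadingShape (proj₁ (ψ n)) (oddTop n) (+ n) (oddN n)) ×
         ((k : ℕ) → 1 ℕ.≤ k → let n = 2 ℕ.* k in
            (proj₁ (ψ n) XAB.≈ XAB.0#) ×
            LeadingShape (proj₂ (ψ n)) (evenTop n) (+ n) (evenN n))
lemma1 ψ H = (λ k → read-odd k (expected (2 ℕ.* k ℕ.+ 1) (ℕP.m≤n+m 1 (2 ℕ.* k))))
           , λ { zero ()
               ; (suc k) _ → read-even k (expected (2 ℕ.* suc k) (s≤s z≤n)) }
  where open Recurrences ψ H using (expected)
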